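{- Let $n\in\mathbb{N}$, $\pi\in S_n'$ and $1\le i\le \operatorname{sc}(\pi)$. Then the subsequence of $s^i(\pi)$ consisting of the entries strictly to the left of $0$ equals the concatenation \[s(b_{\pi,i,1})\,s(b_{\pi,i,2})\cdots s(b_{\pi,i,k})\] where $k=|C_{\pi,i}|$.
   Context: A "permutation" may be any finite sequence of distinct integers. West's stack-sorting map $s$: read the input left to right with an initially empty stack; repeatedly, if the input is nonempty and either the stack is empty or the top of the stack is greater than the next input entry, push the next entry; otherwise pop the top of the stack and append it to the output; stop when input and stack are empty. $s$ of the empty sequence is empty. $\operatorname{sc}(\pi)$ is the least $k\ge0$ with $s^k(\pi)$ increasing. $S_n'$ is the set of permutations of $\{0,1,\dots,n\}$ whose last entry is $0$. Column and block sequences: for $\pi\in S_n'$ and $1\le i\le\operatorname{sc}(\pi)$ let $\sigma=s^{i-1}(\pi)$. Let $c_{\pi,i,1}$ be the maximum of the entries of $\sigma$ strictly left of $0$. For $j\ge2$, as long as there is at least one entry of $\sigma$ strictly between $c_{\pi,i,j-1}$ and $0$, let $c_{\pi,i,j}$ be the maximum of the entries strictly between $c_{\pi,i,j-1}$ and $0$; otherwise the sequence stops. This gives $C_{\pi,i}=(c_{\pi,i,1},\dots,c_{\pi,i,k})$. The blocks are: $b_{\pi,i,1}$ = the (possibly empty) contiguous subsequence of $\sigma$ strictly before $c_{\pi,i,1}$, and for $2\le j\le k$, $b_{\pi,i,j}$ = the (possibly empty) contiguous subsequence of $\sigma$ strictly between $c_{\pi,i,j-1}$ and $c_{\pi,i,j}$.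 -}

module Defs where

open import Data.Nat using (ℕ; zero; suc; _<_; _<ᵇ_; _⊔_; _≡ᵇ_)
open import Data.Bool using (if_then_else_)
open import Data.List using (List; []; _∷_; _++_; [_]; length; foldr; upTo)
open import Data.Product using (_×_; _,_; proj₁; proj₂)
open import Data.List.Relation.Unary.Linked using (Linked)
open import Data.List.Relation.Binary.Permutation.Propositional using (_↭_)
open import Relation.Binary.PropositionalEquality using (_≡_)
open import Relation.Nullary using (¬_)
open import Data.Product using (Σ; ∃)

-- West's stack-sorting map, as a stack machine.
-- stackRun input stack : output produced from this state on.
stackRun : List ℕ → List ℕ → List ℕ
stackRun []       st       = st
stackRun (x ∷ xs) []       = stackRun xs (x ∷ [])
stackRun (x ∷ xs) (t ∷ st) =
  if x <ᵇ t then stackRun xs (x ∷ t ∷ st)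
            else t ∷ stackRun (x ∷ xs) st

s : List ℕ → List ℕ
s π = stackRun π []

s^ : ℕ → List ℕ → List ℕ
s^ zero    π = π
s^ (suc k) π = s (s^ k π)

Increasing : List ℕ → Set
Increasing = Linked _<_

IsSc : List ℕ → ℕ → Set
IsSc π k = Increasing (s^ k π) × (∀ j → j < k → ¬ Increasing (s^ j π))

InS' : ℕ → List ℕ → Set
InS' n π = (π ↭ upTo (suc n)) × ∃ λ ρ → π ≡ ρ ++ [ 0 ]

leftOf0 : List ℕ → List ℕ
leftOf0 []          = []
leftOf0 (zero ∷ _)  = []
leftOf0 (suc x ∷ xs) = suc x ∷ leftOf0 xs

maxL : List ℕ → ℕ
maxL = foldr _⊔_ 0

breakAt : ℕ → List ℕ → List ℕ × List ℕ
breakAt m []       = [] , []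
breakAt m (x ∷ xs) =
  if x ≡ᵇ m then ([] , xs)
  else (x ∷ proj₁ (breakAt m xs) , proj₂ (breakAt m xs))

-- Column/block decomposition of the part L of σ left of 0, with fuel
-- (fuel = length L suffices: each step removes at least the column entry).
-- Column c_j = maximum of the remaining entries (strictly between c_{j-1} and 0),
-- block b_j = the entries strictly between c_{j-1} (or the start) and c_j.
columnsF : ℕ → List ℕ → List ℕ
columnsF zero    _        = []
columnsF (suc f) []       = []
columnsF (suc f) (x ∷ xs) = maxL (x ∷ xs) ∷ columnsF f (proj₂ (breakAt (maxL (x ∷ xs)) (x ∷ xs)))

blocksF : ℕ → List ℕ → List (List ℕ)
blocksF zero    _        = []
blocksF (suc f) []       = []
blocksF (suc f) (x ∷ xs) =
  proj₁ (breakAt (maxL (x ∷ xs)) (x ∷ xs)) ∷ blocksF f (proj₂ (breakAt (maxL (x ∷ xs)) (x ∷ xs)))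

-- C_{π,i} and (b_{π,i,1}, …, b_{π,i,k}) computed from σ = s^{i-1}(π)
columnSeq : List ℕ → ℕ → List ℕ
columnSeq π i = let L = leftOf0 (s^ (i Data.Nat.∸ 1) π) in columnsF (length L) L

blockSeq : List ℕ → ℕ → List (List ℕ)
blockSeq π i = let L = leftOf0 (s^ (i Data.Nat.∸ 1) π) in blocksF (length L) L

{-# OPTIONS --safe #-}
-- Write σ = s^{i-1}(π) = L 0 R.  Each column c_j is larger than everything in its block b_j
-- and than every later entry of L, and smaller than c_{j-1}.  Hence when the stack machine
-- reads c_j, the stack holds only entries of b_j above c_{j-1}: it pops them, which completes
-- the output s(b_j), and pushes c_j onto c_{j-1}.  The columns thus stay on the stack until
-- 0 arrives; 0 is pushed and popped right away, so the output before 0 is s(b_1)⋯s(b_k).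
module Submission where

open import Defs
open import Data.Nat using (ℕ; zero; suc; _≤_; _<_; _<ᵇ_; _≡ᵇ_; z<s; s≤s⁻¹)
open import Data.Nat.Properties
  using (<ᵇ-reflects-<; ≡ᵇ⇒≡; ≡⇒≡ᵇ; ⊔-sel; ⊔-identityʳ; m≤m⊔n; m≤n⊔m; ≤-refl; ≤-trans; ≤-reflexive;
         ≤-<-trans; ≤⇒≯; ≤∧≢⇒<; m+n≤o⇒n≤o)
open import Data.Bool using (true; false)
open import Data.Unit using (⊤)
open import Data.Empty using (⊥-elim)
open import Data.Product using (_×_; _,_; proj₁; proj₂)
open import Data.Sum using (inj₁; inj₂)
open import Data.List using (List; []; _∷_; _++_; [_]; concat; map; length; upTo)
open import Data.List.Properties using (++-assoc; ++-identityʳ; length-++)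
open import Data.List.Relation.Unary.All as All using (All; []; _∷_)
open import Data.List.Relation.Unary.All.Properties using (++⁻ˡ; ++⁻)
open import Data.List.Relation.Unary.Any using (here; there)
open import Data.List.Relation.Unary.AllPairs as AllPairs using (AllPairs; []; _∷_)
open import Data.List.Relation.Unary.Unique.Propositional using (Unique)
open import Data.List.Relation.Unary.Unique.Propositional.Properties using (upTo⁺)
open import Data.List.Membership.Propositional using (_∈_)
open import Data.List.Relation.Binary.Permutation.Propositional
  using (_↭_; ↭-refl; ↭-sym; ↭-trans; ↭-prep; ↭⇒↭ₛ)
open import Data.List.Relation.Binary.Permutation.Propositional.Properties
  using (shift; ∈-resp-↭; All-resp-↭)
import Data.List.Relation.Binary.Permutation.Setoid.Properties as SetoidPermutation
open import Function using (_∘_)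
open import Relation.Binary using (Rel)
open import Relation.Binary.PropositionalEquality
  using (_≡_; refl; sym; trans; cong; subst; setoid; ≢-sym; module ≡-Reasoning)
open import Relation.Nullary.Reflects using (Reflects; ofʸ; ofⁿ; fromEquivalence)

Unique-resp-↭ : ∀ {xs ys : List ℕ} → xs ↭ ys → Unique xs → Unique ys
Unique-resp-↭ = SetoidPermutation.Unique-resp-↭ (setoid ℕ) ∘ ↭⇒↭ₛ

AllPairs-++⁻ˡ : ∀ {a ℓ} {A : Set a} {R : Rel A ℓ} xs {ys} → AllPairs R (xs ++ ys) → AllPairs R xs
AllPairs-++⁻ˡ []       _         = []
AllPairs-++⁻ˡ (x ∷ xs) (px ∷ pxs) = ++⁻ˡ xs px ∷ AllPairs-++⁻ˡ xs pxs

AllPairs-++⁻ʳ : ∀ {a ℓ} {A : Set a} {R : Rel A ℓ} xs {ys} → AllPairs R (xs ++ ys) → AllPairs R ys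
AllPairs-++⁻ʳ []       p         = p
AllPairs-++⁻ʳ (x ∷ xs) (_ ∷ pxs) = AllPairs-++⁻ʳ xs pxs

≡ᵇ-reflects-≡ : ∀ m n → Reflects (m ≡ n) (m ≡ᵇ n)
≡ᵇ-reflects-≡ m n = fromEquivalence (≡ᵇ⇒≡ m n) (≡⇒≡ᵇ m n)

maxL-upperBound : ∀ L → All (_≤ maxL L) L
maxL-upperBound []      = []
maxL-upperBound (x ∷ L) =
  m≤m⊔n x (maxL L) ∷ All.map (λ y≤max → ≤-trans y≤max (m≤n⊔m x (maxL L))) (maxL-upperBound L)

maxL-∈ : ∀ x xs → maxL (x ∷ xs) ∈ x ∷ xs
maxL-∈ x []       = here (⊔-identityʳ x)
maxL-∈ x (y ∷ xs) with ⊔-sel x (maxL (y ∷ xs))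
... | inj₁ max≡x = here max≡x
... | inj₂ max≡m = there (subst (_∈ y ∷ xs) (sym max≡m) (maxL-∈ y xs))

breakAt-++ : ∀ {c L} → c ∈ L → proj₁ (breakAt c L) ++ c ∷ proj₂ (breakAt c L) ≡ L
breakAt-++ {c} {x ∷ L} c∈ with x ≡ᵇ c | ≡ᵇ-reflects-≡ x c | c∈
... | true  | ofʸ refl | _         = refl
... | false | ofⁿ x≢c | here c≡x  = ⊥-elim (x≢c (sym c≡x))
... | false | ofⁿ _   | there c∈L = cong (x ∷_) (breakAt-++ c∈L)

stackRun-↭ : ∀ xs st → stackRun xs st ↭ xs ++ st
stackRun-↭ []       st = ↭-refl
stackRun-↭ (x ∷ xs) st = reading-x st
  where
    reading-x : ∀ st → stackRun (x ∷ xs) st ↭ (x ∷ xs) ++ st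
    reading-x []       = ↭-trans (stackRun-↭ xs [ x ]) (shift x xs [])
    reading-x (t ∷ st) with x <ᵇ t
    ... | true  = ↭-trans (stackRun-↭ xs (x ∷ t ∷ st)) (shift x xs (t ∷ st))
    ... | false = ↭-trans (↭-prep t (reading-x st)) (↭-sym (shift t (x ∷ xs) st))

s-↭ : ∀ xs → s xs ↭ xs
s-↭ xs = subst (s xs ↭_) (++-identityʳ xs) (stackRun-↭ xs [])

s^-↭ : ∀ j π → s^ j π ↭ π
s^-↭ zero    π = ↭-refl
s^-↭ (suc j) π = ↭-trans (s-↭ (s^ j π)) (s^-↭ j π)

_<Top_ : ℕ → List ℕ → Set
x <Top []      = ⊤
x <Top (t ∷ _) = x < t

≤-<Top-trans : ∀ {x c st} → x ≤ c → c <Top st → x <Top st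
≤-<Top-trans {st = []}    _   _   = _
≤-<Top-trans {st = _ ∷ _} x≤c c<t = ≤-<-trans x≤c c<t

stackRun-push : ∀ {x xs st} → x <Top st → stackRun (x ∷ xs) st ≡ stackRun xs (x ∷ st)
stackRun-push {st = []}        _   = refl
stackRun-push {x} {st = t ∷ _} x<t with x <ᵇ t | <ᵇ-reflects-< x t
... | true  | _        = refl
... | false | ofⁿ x≮t = ⊥-elim (x≮t x<t)

stackRun-popAll : ∀ {c rest st} st₀ → All (_≤ c) st₀ →
  stackRun (c ∷ rest) (st₀ ++ st) ≡ st₀ ++ stackRun (c ∷ rest) st
stackRun-popAll     []        _             = refl
stackRun-popAll {c} (t ∷ st₀) (t≤c ∷ st₀≤c) with c <ᵇ t | <ᵇ-reflects-< c t
... | true  | ofʸ c<t = ⊥-elim (≤⇒≯ t≤c c<t)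
... | false | _        = cong (t ∷_) (stackRun-popAll st₀ st₀≤c)

-- st₀ is the stack built so far while reading b; it rests on st, whose top exceeds c.
stackRun-column : ∀ b st₀ {c rest st} → All (_≤ c) b → All (_≤ c) st₀ → c <Top st →
  stackRun (b ++ c ∷ rest) (st₀ ++ st) ≡ stackRun b st₀ ++ stackRun rest (c ∷ st)
stackRun-column []      st₀ _ st₀≤c c<st =
  trans (stackRun-popAll st₀ st₀≤c) (cong (st₀ ++_) (stackRun-push c<st))
stackRun-column (x ∷ b) st₀ {c} {rest} {st} (x≤c ∷ b≤c) st₀≤c c<st = reading-x st₀ st₀≤c
  where
    reading-x : ∀ st₀ → All (_≤ c) st₀ →
      stackRun (x ∷ b ++ c ∷ rest) (st₀ ++ st) ≡ stackRun (x ∷ b) st₀ ++ stackRun rest (c ∷ st)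
    reading-x [] _ =
      trans (stackRun-push (≤-<Top-trans x≤c c<st)) (stackRun-column b [ x ] b≤c (x≤c ∷ []) c<st)
    reading-x (t ∷ st₀) (t≤c ∷ st₀≤c) with x <ᵇ t
    ... | true  = stackRun-column b (x ∷ t ∷ st₀) b≤c (x≤c ∷ t≤c ∷ st₀≤c) c<st
    ... | false = cong (t ∷_) (reading-x st₀ st₀≤c)

leftOf0-stackRun-0-on-top : ∀ R st → leftOf0 (stackRun R (0 ∷ st)) ≡ []
leftOf0-stackRun-0-on-top []      _ = refl
leftOf0-stackRun-0-on-top (_ ∷ _) _ = refl

leftOf0-stackRun-0∷ : ∀ R st → leftOf0 (stackRun (0 ∷ R) st) ≡ []
leftOf0-stackRun-0∷ R []          = leftOf0-stackRun-0-on-top R []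
leftOf0-stackRun-0∷ R (zero ∷ _)  = refl
leftOf0-stackRun-0∷ R (suc t ∷ st) = leftOf0-stackRun-0-on-top R (suc t ∷ st)

leftOf0-++ : ∀ A B → All (0 <_) A → leftOf0 (A ++ B) ≡ A ++ leftOf0 B
leftOf0-++ []          _ _         = refl
leftOf0-++ (suc x ∷ A) B (_ ∷ A>0) = cong (suc x ∷_) (leftOf0-++ A B A>0)

leftOf0-positive : ∀ σ → All (0 <_) (leftOf0 σ)
leftOf0-positive []          = []
leftOf0-positive (zero ∷ _)  = []
leftOf0-positive (suc _ ∷ σ) = z<s ∷ leftOf0-positive σ

rightOf0 : List ℕ → List ℕ
rightOf0 []          = []
rightOf0 (zero ∷ σ)  = σ
rightOf0 (suc _ ∷ σ) = rightOf0 σ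

leftOf0-++-rightOf0 : ∀ {σ} → 0 ∈ σ → leftOf0 σ ++ 0 ∷ rightOf0 σ ≡ σ
leftOf0-++-rightOf0 {zero ∷ _}  _          = refl
leftOf0-++-rightOf0 {suc x ∷ _} (there 0∈σ) = cong (suc x ∷_) (leftOf0-++-rightOf0 0∈σ)

leftOf0-stackRun-blocks : ∀ f L R st → length L ≤ f → Unique L → All (0 <_) L → All (_<Top st) L →
  leftOf0 (stackRun (L ++ 0 ∷ R) st) ≡ concat (map s (blocksF f L))
leftOf0-stackRun-blocks zero    [] R st _ _ _ _ = leftOf0-stackRun-0∷ R st
leftOf0-stackRun-blocks (suc _) [] R st _ _ _ _ = leftOf0-stackRun-0∷ R st
leftOf0-stackRun-blocks (suc f) L@(x ∷ xs) R st len L-unique L>0 L<st = begin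
    leftOf0 (stackRun (L ++ 0 ∷ R) st)
  ≡⟨ cong (λ M → leftOf0 (stackRun (M ++ 0 ∷ R) st)) (sym L≡) ⟩
    leftOf0 (stackRun ((b ++ c ∷ rest) ++ 0 ∷ R) st)
  ≡⟨ cong (λ M → leftOf0 (stackRun M st)) (++-assoc b (c ∷ rest) (0 ∷ R)) ⟩
    leftOf0 (stackRun (b ++ c ∷ rest ++ 0 ∷ R) st)
  ≡⟨ cong leftOf0 (stackRun-column b [] b≤c [] c<st) ⟩
    leftOf0 (s b ++ stackRun (rest ++ 0 ∷ R) (c ∷ st))
  ≡⟨ leftOf0-++ (s b) _ (All-resp-↭ (↭-sym (s-↭ b)) b>0) ⟩
    s b ++ leftOf0 (stackRun (rest ++ 0 ∷ R) (c ∷ st))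
  ≡⟨ cong (s b ++_) (leftOf0-stackRun-blocks f rest R (c ∷ st) rest-length rest-unique rest>0 rest<c) ⟩
    s b ++ concat (map s (blocksF f rest))
  ∎
  where
    open ≡-Reasoning
    c : ℕ
    c = maxL L

    b rest : List ℕ
    b    = proj₁ (breakAt c L)
    rest = proj₂ (breakAt c L)

    L≡ : b ++ c ∷ rest ≡ L
    L≡ = breakAt-++ (maxL-∈ x xs)

    split : ∀ {P : ℕ → Set} → All P L → All P b × All P (c ∷ rest)
    split = ++⁻ b ∘ subst (All _) (sym L≡)

    b≤c : All (_≤ c) b
    b≤c = proj₁ (split (maxL-upperBound L))

    b>0 : All (0 <_) b
    b>0 = proj₁ (split L>0)

    c<st : c <Top st
    c<st = All.head (proj₂ (split L<st))

    rest>0 : All (0 <_) rest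
    rest>0 = All.tail (proj₂ (split L>0))

    c∷rest-unique : Unique (c ∷ rest)
    c∷rest-unique = AllPairs-++⁻ʳ b (subst Unique (sym L≡) L-unique)

    rest-unique : Unique rest
    rest-unique = AllPairs.tail c∷rest-unique

    rest<c : All (_< c) rest
    rest<c = All.zipWith (λ (y≤c , c≢y) → ≤∧≢⇒< y≤c (≢-sym c≢y))
               (All.tail (proj₂ (split (maxL-upperBound L))) , AllPairs.head c∷rest-unique)

    rest-length : length rest ≤ f
    rest-length = s≤s⁻¹ (m+n≤o⇒n≤o (length b)
      (≤-trans (≤-reflexive (trans (sym (length-++ b)) (cong length L≡))) len))

-- Only the distinctness of the entries and 0 ∈ π are used.
lemma3p4 : (n : ℕ) (π : List ℕ) (k i : ℕ) → InS' n π → IsSc π k → 1 ≤ i → i ≤ k →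
    leftOf0 (s^ i π) ≡ concat (map s (blockSeq π i))
lemma3p4 n π k (suc i) (π↭ , _) _ _ _ = begin
    leftOf0 (s σ)                     ≡⟨ cong (leftOf0 ∘ s) (sym σ≡) ⟩
    leftOf0 (s (L ++ 0 ∷ rightOf0 σ)) ≡⟨ leftOf0-stackRun-blocks (length L) L (rightOf0 σ) []
                                          ≤-refl L-unique (leftOf0-positive σ) (All.universal _ L) ⟩
    concat (map s (blockSeq π (suc i))) ∎
  where
    open ≡-Reasoning
    σ L : List ℕ
    σ = s^ i π
    L = leftOf0 σ

    σ↭ : σ ↭ upTo (suc n)
    σ↭ = ↭-trans (s^-↭ i π) π↭

    σ≡ : L ++ 0 ∷ rightOf0 σ ≡ σ
    σ≡ = leftOf0-++-rightOf0 (∈-resp-↭ (↭-sym σ↭) (here refl))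

    L-unique : Unique L
    L-unique = AllPairs-++⁻ˡ L (subst Unique (sym σ≡) (Unique-resp-↭ (↭-sym σ↭) (upTo⁺ (suc n))))
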